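{- For all terms $M, N$: if $M =_{\mathsf v} N$, then $M \cong N$.
   Context: Terms and values of the call-by-value $\lambda$-calculus are defined by mutual induction from a countably infinite set of variables: values $V ::= x \mid \lambda x.M$ and terms $M,N,L ::= V \mid MN$, up to $\alpha$-conversion, application associating to the left; $\mathrm{fv}(M)$ is the set of free variables and $M\{V/x\}$ capture-avoiding substitution of a value. Root rules: $(\lambda x.M)V \mapsto_{\beta_v} M\{V/x\}$ ($V$ a value); $(\lambda x.M)NL \mapsto_{\sigma_1} (\lambda x.ML)N$ if $x\notin\mathrm{fv}(L)$; $V((\lambda x.L)N) \mapsto_{\sigma_3} (\lambda x.VL)N$ ($V$ a value, $x\notin\mathrm{fv}(V)$); $\mapsto_{\mathsf v}=\mapsto_{\beta_v}\cup\mapsto_{\sigma_1}\cup\mapsto_{\sigma_3}$. Contexts are $C ::= [\cdot]\mid \lambda x.C\mid CM\mid MC$, and $C[M]$ is the term obtained by capture-allowing replacement of the hole by $M$. $\to_{\mathsf v}$ is the closure of $\mapsto_{\mathsf v}$ under contexts, and $=_{\mathsf v}$ is the reflexive, symmetric, transitive closure of $\to_{\mathsf v}$. Head $\beta_v$-reduction $\to_{h\beta_v}$ is the least relation with: $(\lambda x.M)V M_1\dots M_m \to_{h\beta_v} M\{V/x\}M_1\dots M_m$ ($V$ value, $m\ge0$); if $N\to_{h\beta_v}N'$ then $VNM_1\dots M_m\to_{h\beta_v}VN'M_1\dots M_m$ ($V$ value). A term $M$ halts if $M\to_{h\beta_v}^* V$ for some value $V$ ($^*$ = reflexive-transitive closure).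 Observational equivalence: $M\cong N$ iff for every context $C$, $C[M]$ halts iff $C[N]$ halts. -}

module Defs where

open import Data.Nat using (ℕ; zero; suc)
open import Data.List using (List; []; _∷_; foldl)
open import Data.Product using (∃; _×_)
open import Relation.Binary.Construct.Closure.ReflexiveTransitive using (Star)
open import Relation.Binary.Construct.Closure.Equivalence using (EqClosure)

-- Untyped λ-terms with de Bruijn indices (terms up to α-conversion).
-- Values are the terms of the form  var i  or  lam M.
data Term : Set where
  var : ℕ → Term
  lam : Term → Term
  app : Term → Term → Term

data Value : Term → Set where
  v-var : ∀ {i} → Value (var i)
  v-lam : ∀ {M} → Value (lam M)

ext : (ℕ → ℕ) → ℕ → ℕ
ext ρ zero    = zero
ext ρ (suc i) = suc (ρ i)

rename : (ℕ → ℕ) → Term → Term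
rename ρ (var i)   = var (ρ i)
rename ρ (lam M)   = lam (rename (ext ρ) M)
rename ρ (app M N) = app (rename ρ M) (rename ρ N)

shift : Term → Term
shift = rename suc

exts : (ℕ → Term) → ℕ → Term
exts σ zero    = var zero
exts σ (suc i) = shift (σ i)

subst : (ℕ → Term) → Term → Term
subst σ (var i)   = σ i
subst σ (lam M)   = lam (subst (exts σ) M)
subst σ (app M N) = app (subst σ M) (subst σ N)

-- M{V/x} where x is the variable bound by the enclosing λ (index 0)
_[_] : Term → Term → Term
M [ V ] = subst σ M
  where
  σ : ℕ → Term
  σ zero    = V
  σ (suc i) = var i

-- Root rules.  The side conditions x ∉ fv(L), x ∉ fv(V) are expressed by
-- the shifted (weakened) term under the new binder.
data _↦v_ : Term → Term → Set where
  βv : ∀ {M V} → Value V → app (lam M) V ↦v (M [ V ])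
  σ₁ : ∀ {M N L} → app (app (lam M) N) L ↦v app (lam (app M (shift L))) N
  σ₃ : ∀ {V L N} → Value V → app V (app (lam L) N) ↦v app (lam (app (shift V) L)) N

-- Contexts and capture-allowing plugging
data Ctx : Set where
  hole : Ctx
  lamC : Ctx → Ctx
  appL : Ctx → Term → Ctx
  appR : Term → Ctx → Ctx

plug : Ctx → Term → Term
plug hole       M = M
plug (lamC C)   M = lam (plug C M)
plug (appL C N) M = app (plug C M) N
plug (appR N C) M = app N (plug C M)

data _→v_ : Term → Term → Set where
  ctx : ∀ C {M N} → M ↦v N → plug C M →v plug C N

_=v_ : Term → Term → Set
_=v_ = EqClosure _→v_

apps : Term → List Term → Term
apps = foldl app

data _→hβv_ : Term → Term → Set where
  hβ  : ∀ {M V} Ms → Value V → apps (app (lam M) V) Ms →hβv apps (M [ V ]) Ms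
  hAr : ∀ {V N N'} Ms → Value V → N →hβv N' → apps (app V N) Ms →hβv apps (app V N') Ms

_→hβv*_ : Term → Term → Set
_→hβv*_ = Star _→hβv_

Halts : Term → Set
Halts M = ∃ λ V → Value V × (M →hβv* V)

_≅_ : Term → Term → Set
M ≅ N = ∀ (C : Ctx) → (Halts (plug C M) → Halts (plug C N)) × (Halts (plug C N) → Halts (plug C M))

module Submission where

-- The proof goes through Takahashi-style parallel reduction ⇛, which contains
-- one →v step in any context and is compatible with renaming and with
-- substitution of values.  Halting is characterised by a big-step evaluation
-- relation ⇓ (M halts iff M ⇓ W for some value W).  Two simulation lemmas
-- then show that ⇛ neither creates nor destroys evaluations:
--   * forward:  M ⇓ W and M ⇛ N give N ⇓ W' with W ⇛ W';
--   * backward: N ⇓ W' and M ⇛ N give M ⇓ W with W ⇛ W'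
--     (proved under an arbitrary pair of parallel value substitutions, so that
--     the β case can be simulated by induction on the evaluation of the body).
-- Hence every →v step, in every context, preserves and reflects halting, i.e.
-- →v ⊆ ≅.  Since ≅ is an equivalence relation, it contains the equivalence
-- closure =v of →v, which is the theorem.

open import Defs
open import Data.Nat using (ℕ; zero; suc)
open import Data.List using ([]; _∷_; _∷ʳ_)
open import Data.List.Properties using (foldl-∷ʳ)
open import Data.Product using (∃; _×_; _,_; proj₁; proj₂; swap)
open import Function using (_∘_; id)
open import Relation.Binary.Structures using (IsEquivalence)
open import Relation.Binary.PropositionalEquality
  using (_≡_; _≗_; refl; sym; trans; cong; cong₂)
  renaming (subst to transport; subst₂ to transport₂)
open import Relation.Binary.Construct.Closure.ReflexiveTransitive using (ε; _◅_; _◅◅_)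
open import Relation.Binary.Construct.Closure.Equivalence using (fold)

-- Substitution algebra

ext-cong : ∀ {ρ ρ'} → ρ ≗ ρ' → ext ρ ≗ ext ρ'
ext-cong e zero    = refl
ext-cong e (suc i) = cong suc (e i)

rename-cong : ∀ {ρ ρ'} → ρ ≗ ρ' → ∀ M → rename ρ M ≡ rename ρ' M
rename-cong e (var i)   = cong var (e i)
rename-cong e (lam M)   = cong lam (rename-cong (ext-cong e) M)
rename-cong e (app M N) = cong₂ app (rename-cong e M) (rename-cong e N)

exts-cong : ∀ {σ σ'} → σ ≗ σ' → exts σ ≗ exts σ'
exts-cong e zero    = refl
exts-cong e (suc i) = cong shift (e i)

subst-cong : ∀ {σ σ'} → σ ≗ σ' → ∀ M → subst σ M ≡ subst σ' M
subst-cong e (var i)   = e i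
subst-cong e (lam M)   = cong lam (subst-cong (exts-cong e) M)
subst-cong e (app M N) = cong₂ app (subst-cong e M) (subst-cong e N)

rename-rename : ∀ ρ ρ' M → rename ρ (rename ρ' M) ≡ rename (ρ ∘ ρ') M
rename-rename ρ ρ' (var i)   = refl
rename-rename ρ ρ' (lam M)   =
  cong lam (trans (rename-rename (ext ρ) (ext ρ') M) (rename-cong ext-∘ M))
  where
  ext-∘ : ext ρ ∘ ext ρ' ≗ ext (ρ ∘ ρ')
  ext-∘ zero    = refl
  ext-∘ (suc i) = refl
rename-rename ρ ρ' (app M N) = cong₂ app (rename-rename ρ ρ' M) (rename-rename ρ ρ' N)

subst-rename : ∀ σ ρ M → subst σ (rename ρ M) ≡ subst (σ ∘ ρ) M
subst-rename σ ρ (var i)   = refl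
subst-rename σ ρ (lam M)   =
  cong lam (trans (subst-rename (exts σ) (ext ρ) M) (subst-cong exts-∘ M))
  where
  exts-∘ : exts σ ∘ ext ρ ≗ exts (σ ∘ ρ)
  exts-∘ zero    = refl
  exts-∘ (suc i) = refl
subst-rename σ ρ (app M N) = cong₂ app (subst-rename σ ρ M) (subst-rename σ ρ N)

rename-subst : ∀ ρ σ M → rename ρ (subst σ M) ≡ subst (rename ρ ∘ σ) M
rename-subst ρ σ (var i)   = refl
rename-subst ρ σ (lam M)   =
  cong lam (trans (rename-subst (ext ρ) (exts σ) M) (subst-cong ext-exts M))
  where
  ext-exts : rename (ext ρ) ∘ exts σ ≗ exts (rename ρ ∘ σ)
  ext-exts zero    = refl
  ext-exts (suc i) = trans (rename-rename (ext ρ) suc (σ i)) (sym (rename-rename suc ρ (σ i)))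
rename-subst ρ σ (app M N) = cong₂ app (rename-subst ρ σ M) (rename-subst ρ σ N)

subst-subst : ∀ σ τ M → subst σ (subst τ M) ≡ subst (subst σ ∘ τ) M
subst-subst σ τ (var i)   = refl
subst-subst σ τ (lam M)   =
  cong lam (trans (subst-subst (exts σ) (exts τ) M) (subst-cong exts-exts M))
  where
  exts-exts : subst (exts σ) ∘ exts τ ≗ exts (subst σ ∘ τ)
  exts-exts zero    = refl
  exts-exts (suc i) = trans (subst-rename (exts σ) suc (τ i)) (sym (rename-subst suc σ (τ i)))
subst-subst σ τ (app M N) = cong₂ app (subst-subst σ τ M) (subst-subst σ τ N)

subst-id : ∀ {σ} → σ ≗ var → ∀ M → subst σ M ≡ M
subst-id e (var i)   = e i
subst-id e (lam M)   = cong lam (subst-id exts-id M)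
  where
  exts-id : exts _ ≗ var
  exts-id zero    = refl
  exts-id (suc i) = cong shift (e i)
subst-id e (app M N) = cong₂ app (subst-id e M) (subst-id e N)

subst-var : ∀ M → subst var M ≡ M
subst-var = subst-id (λ _ → refl)

_•_ : Term → (ℕ → Term) → ℕ → Term
(V • σ) zero    = V
(V • σ) (suc i) = σ i

[]-as-subst : ∀ M V → M [ V ] ≡ subst (V • var) M
[]-as-subst M V = subst-cong pointwise M
  where
  pointwise : _ ≗ V • var
  pointwise zero    = refl
  pointwise (suc i) = refl

subst-•-shift : ∀ V σ L → subst (V • σ) (shift L) ≡ subst σ L
subst-•-shift V σ L = subst-rename (V • σ) suc L

shift-[] : ∀ L V → shift L [ V ] ≡ L
shift-[] L V = trans ([]-as-subst (shift L) V) (trans (subst-•-shift V var L) (subst-var L))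

exts-[] : ∀ σ P W → subst (exts σ) P [ W ] ≡ subst (W • σ) P
exts-[] σ P W =
  trans ([]-as-subst (subst (exts σ) P) W)
        (trans (subst-subst (W • var) (exts σ) P) (subst-cong pointwise P))
  where
  pointwise : subst (W • var) ∘ exts σ ≗ W • σ
  pointwise zero    = refl
  pointwise (suc i) = trans (subst-•-shift W var (σ i)) (subst-var (σ i))

subst-[] : ∀ σ P V → subst σ (P [ V ]) ≡ subst (subst σ V • σ) P
subst-[] σ P V =
  trans (cong (subst σ) ([]-as-subst P V))
        (trans (subst-subst σ (V • var) P) (subst-cong pointwise P))
  where
  pointwise : subst σ ∘ (V • var) ≗ subst σ V • σ
  pointwise zero    = refl
  pointwise (suc i) = refl

subst-exts-shift : ∀ σ L → subst (exts σ) (shift L) ≡ shift (subst σ L)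
subst-exts-shift σ L = trans (subst-rename (exts σ) suc L) (sym (rename-subst suc σ L))

rename-ext-shift : ∀ ρ L → rename (ext ρ) (shift L) ≡ shift (rename ρ L)
rename-ext-shift ρ L = trans (rename-rename (ext ρ) suc L) (sym (rename-rename suc ρ L))

-- The shape produced by σ₁ and σ₃ after substitution and instantiation.
subst-shift-[] : ∀ σ L U → subst (exts σ) (shift L) [ U ] ≡ subst σ L
subst-shift-[] σ L U = trans (cong (_[ U ]) (subst-exts-shift σ L)) (shift-[] (subst σ L) U)

rename-[] : ∀ ρ P V → rename ρ (P [ V ]) ≡ rename (ext ρ) P [ rename ρ V ]
rename-[] ρ P V =
  trans (cong (rename ρ) ([]-as-subst P V))
  (trans (rename-subst ρ (V • var) P)
  (trans (subst-cong pointwise P)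
  (sym (trans ([]-as-subst (rename (ext ρ) P) (rename ρ V))
              (subst-rename (rename ρ V • var) (ext ρ) P)))))
  where
  pointwise : rename ρ ∘ (V • var) ≗ (rename ρ V • var) ∘ ext ρ
  pointwise zero    = refl
  pointwise (suc i) = refl

-- Substitutions mapping every index to a value: the only ones the
-- call-by-value calculus ever performs.
ValueSubst : (ℕ → Term) → Set
ValueSubst σ = ∀ i → Value (σ i)

value-rename : ∀ {V} ρ → Value V → Value (rename ρ V)
value-rename ρ v-var = v-var
value-rename ρ v-lam = v-lam

value-subst : ∀ {V σ} → ValueSubst σ → Value V → Value (subst σ V)
value-subst vs (v-var {i}) = vs i
value-subst vs v-lam       = v-lam

exts-value : ∀ {σ} → ValueSubst σ → ValueSubst (exts σ)
exts-value vs zero    = v-var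
exts-value vs (suc i) = value-rename suc (vs i)

•-value : ∀ {V σ} → Value V → ValueSubst σ → ValueSubst (V • σ)
•-value v vs zero    = v
•-value v vs (suc i) = vs i

var-value : ValueSubst var
var-value i = v-var

infix 4 _⇛_ _⇛ₛ_
data _⇛_ : Term → Term → Set where
  pvar : ∀ {i} → var i ⇛ var i
  plam : ∀ {M M'} → M ⇛ M' → lam M ⇛ lam M'
  papp : ∀ {M M' N N'} → M ⇛ M' → N ⇛ N' → app M N ⇛ app M' N'
  pβ   : ∀ {M M' V V'} → M ⇛ M' → V ⇛ V' → Value V → app (lam M) V ⇛ M' [ V' ]
  pσ₁  : ∀ {M M' N N' L L'} → M ⇛ M' → N ⇛ N' → L ⇛ L' →
         app (app (lam M) N) L ⇛ app (lam (app M' (shift L'))) N'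
  pσ₃  : ∀ {V V' L L' N N'} → V ⇛ V' → Value V → L ⇛ L' → N ⇛ N' →
         app V (app (lam L) N) ⇛ app (lam (app (shift V') L')) N'

⇛-refl : ∀ M → M ⇛ M
⇛-refl (var i)   = pvar
⇛-refl (lam M)   = plam (⇛-refl M)
⇛-refl (app M N) = papp (⇛-refl M) (⇛-refl N)

↦v⊆⇛ : ∀ {M N} → M ↦v N → M ⇛ N
↦v⊆⇛ (βv v) = pβ (⇛-refl _) (⇛-refl _) v
↦v⊆⇛ σ₁     = pσ₁ (⇛-refl _) (⇛-refl _) (⇛-refl _)
↦v⊆⇛ (σ₃ v) = pσ₃ (⇛-refl _) v (⇛-refl _) (⇛-refl _)

plug-⇛ : ∀ C {M N} → M ⇛ N → plug C M ⇛ plug C N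
plug-⇛ hole       p = p
plug-⇛ (lamC C)   p = plam (plug-⇛ C p)
plug-⇛ (appL C L) p = papp (plug-⇛ C p) (⇛-refl L)
plug-⇛ (appR L C) p = papp (⇛-refl L) (plug-⇛ C p)

→v⊆⇛ : ∀ {M N} → M →v N → M ⇛ N
→v⊆⇛ (ctx C s) = plug-⇛ C (↦v⊆⇛ s)

value-⇛ : ∀ {V V'} → Value V → V ⇛ V' → Value V'
value-⇛ v-var pvar     = v-var
value-⇛ v-lam (plam p) = v-lam

value-⇛-lam : ∀ {A R'} → Value A → A ⇛ lam R' → ∃ λ R → A ≡ lam R × R ⇛ R'
value-⇛-lam v-lam (plam p) = _ , refl , p

rename-⇛ : ∀ {M M'} ρ → M ⇛ M' → rename ρ M ⇛ rename ρ M'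
rename-⇛ ρ pvar       = pvar
rename-⇛ ρ (plam p)   = plam (rename-⇛ (ext ρ) p)
rename-⇛ ρ (papp p q) = papp (rename-⇛ ρ p) (rename-⇛ ρ q)
rename-⇛ ρ (pβ {M' = M'} {V' = V'} p q v) =
  transport (_ ⇛_) (sym (rename-[] ρ M' V'))
    (pβ (rename-⇛ (ext ρ) p) (rename-⇛ ρ q) (value-rename ρ v))
rename-⇛ ρ (pσ₁ {M' = M'} {N' = N'} {L' = L'} p q r) =
  transport (λ X → _ ⇛ app (lam (app (rename (ext ρ) M') X)) (rename ρ N'))
    (sym (rename-ext-shift ρ L'))
    (pσ₁ (rename-⇛ (ext ρ) p) (rename-⇛ ρ q) (rename-⇛ ρ r))
rename-⇛ ρ (pσ₃ {V' = V'} {L' = L'} {N' = N'} p v q r) =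
  transport (λ X → _ ⇛ app (lam (app X (rename (ext ρ) L'))) (rename ρ N'))
    (sym (rename-ext-shift ρ V'))
    (pσ₃ (rename-⇛ ρ p) (value-rename ρ v) (rename-⇛ (ext ρ) q) (rename-⇛ ρ r))

_⇛ₛ_ : (ℕ → Term) → (ℕ → Term) → Set
σ ⇛ₛ σ' = ∀ i → σ i ⇛ σ' i

exts-⇛ : ∀ {σ σ'} → σ ⇛ₛ σ' → exts σ ⇛ₛ exts σ'
exts-⇛ ps zero    = pvar
exts-⇛ ps (suc i) = rename-⇛ suc (ps i)

•-⇛ : ∀ {V V' σ σ'} → V ⇛ V' → σ ⇛ₛ σ' → (V • σ) ⇛ₛ (V' • σ')
•-⇛ p ps zero    = p
•-⇛ p ps (suc i) = ps i

var-⇛ : var ⇛ₛ var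
var-⇛ i = pvar

value-subst-⇛ : ∀ {σ σ'} → ValueSubst σ → σ ⇛ₛ σ' → ValueSubst σ'
value-subst-⇛ vs ps i = value-⇛ (vs i) (ps i)

-- Substitution lemma: ⇛ is compatible with parallel value substitutions
-- (values are needed so that substituted βv redexes remain redexes).
subst-⇛ : ∀ {M M' σ σ'} → M ⇛ M' → σ ⇛ₛ σ' → ValueSubst σ → subst σ M ⇛ subst σ' M'
subst-⇛ pvar       ps vs = ps _
subst-⇛ (plam p)   ps vs = plam (subst-⇛ p (exts-⇛ ps) (exts-value vs))
subst-⇛ (papp p q) ps vs = papp (subst-⇛ p ps vs) (subst-⇛ q ps vs)
subst-⇛ {σ' = σ'} (pβ {M' = M'} {V' = V'} p q v) ps vs =
  transport (_ ⇛_) (trans (exts-[] σ' M' (subst σ' V')) (sym (subst-[] σ' M' V')))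
    (pβ (subst-⇛ p (exts-⇛ ps) (exts-value vs)) (subst-⇛ q ps vs) (value-subst vs v))
subst-⇛ {σ' = σ'} (pσ₁ {M' = M'} {N' = N'} {L' = L'} p q r) ps vs =
  transport (λ X → _ ⇛ app (lam (app (subst (exts σ') M') X)) (subst σ' N'))
    (sym (subst-exts-shift σ' L'))
    (pσ₁ (subst-⇛ p (exts-⇛ ps) (exts-value vs)) (subst-⇛ q ps vs) (subst-⇛ r ps vs))
subst-⇛ {σ' = σ'} (pσ₃ {V' = V'} {L' = L'} {N' = N'} p v q r) ps vs =
  transport (λ X → _ ⇛ app (lam (app X (subst (exts σ') L'))) (subst σ' N'))
    (sym (subst-exts-shift σ' V'))
    (pσ₃ (subst-⇛ p ps vs) (value-subst vs v) (subst-⇛ q (exts-⇛ ps) (exts-value vs))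
         (subst-⇛ r ps vs))

[]-⇛ : ∀ {M M' V V'} → M ⇛ M' → V ⇛ V' → Value V → M [ V ] ⇛ M' [ V' ]
[]-⇛ {M} {M'} {V} {V'} p q v =
  transport₂ _⇛_ (sym ([]-as-subst M V)) (sym ([]-as-subst M' V'))
    (subst-⇛ p (•-⇛ q var-⇛) (•-value v var-value))

-- Big-step call-by-value evaluation

infix 4 _⇓_
data _⇓_ : Term → Term → Set where
  ev-val : ∀ {V} → Value V → V ⇓ V
  ev-app : ∀ {M N P V W} → M ⇓ lam P → N ⇓ V → P [ V ] ⇓ W → app M N ⇓ W

⇓-value : ∀ {M W} → M ⇓ W → Value W
⇓-value (ev-val v)     = v
⇓-value (ev-app _ _ d) = ⇓-value d

value-⇓ : ∀ {V W} → Value V → V ⇓ W → W ≡ V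
value-⇓ v-var (ev-val _) = refl
value-⇓ v-lam (ev-val _) = refl

⇓-forward : ∀ {M W N} → M ⇓ W → M ⇛ N → ∃ λ W' → N ⇓ W' × W ⇛ W'
⇓-forward (ev-val v) p = _ , ev-val (value-⇛ v p) , p
⇓-forward (ev-app dM dN dB) (papp p q)
  with ⇓-forward dM p | ⇓-forward dN q
... | _ , eM , plam pB | _ , eN , pV
  with ⇓-forward dB ([]-⇛ pB pV (⇓-value dN))
... | W' , eB , pW = W' , ev-app eM eN eB , pW
⇓-forward (ev-app (ev-val _) dV dB) (pβ p q v) with value-⇓ v dV
... | refl = ⇓-forward dB ([]-⇛ p q v)
-- (λ.P) Q L: evaluate Q, then P[Q's value] to a λ R, then L, then R.
⇓-forward (ev-app (ev-app (ev-val _) dQ dP) dL dR) (pσ₁ {M' = P'} {L' = L'} p q r)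
  with ⇓-forward dQ q
... | U' , eQ , pU
  with ⇓-forward dP ([]-⇛ p pU (⇓-value dQ)) | ⇓-forward dL r
... | _ , eP , plam pR | A' , eL , pA
  with ⇓-forward dR ([]-⇛ pR pA (⇓-value dL))
... | W' , eR , pW =
  W' , ev-app (ev-val v-lam) eQ
         (ev-app eP (transport (_⇓ A') (sym (shift-[] L' U')) eL) eR) , pW
-- V ((λ.L) Q) with V = λ.R: evaluate Q, then L[Q's value], then R.
⇓-forward (ev-app (ev-val _) (ev-app (ev-val _) dQ dL) dR)
          (pσ₃ {V' = lam R'} (plam pR) v-lam q r)
  with ⇓-forward dQ r
... | U' , eQ , pU
  with ⇓-forward dL ([]-⇛ q pU (⇓-value dQ))
... | A' , eL , pA
  with ⇓-forward dR ([]-⇛ pR pA (⇓-value dL))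
... | W' , eR , pW =
  W' , ev-app (ev-val v-lam) eQ
         (ev-app (transport (_⇓ lam R') (sym (shift-[] (lam R') U')) (ev-val v-lam)) eL eR) , pW

-- It is
-- stated for a parallel pair of value substitutions σ ⇛ₛ σ': whenever the
-- reduct, instantiated by σ', evaluates, so does the source instantiated by σ.
-- The βv case then simulates the body under the extended substitutions by
-- induction on the same evaluation; the σ₁ and σ₃ cases are split off below.
⇓-backward : ∀ {M M' σ σ' N W'} → N ⇓ W' → M ⇛ M' → σ ⇛ₛ σ' → ValueSubst σ →
             N ≡ subst σ' M' → ∃ λ W → subst σ M ⇓ W × W ⇛ W'

⇓-backward-σ₁ : ∀ {P P' Q Q' L L' σ σ' U' R' A' W'} →
  subst σ' Q' ⇓ U' → subst (exts σ') P' [ U' ] ⇓ lam R' →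
  subst (exts σ') (shift L') [ U' ] ⇓ A' → R' [ A' ] ⇓ W' →
  P ⇛ P' → Q ⇛ Q' → L ⇛ L' → σ ⇛ₛ σ' → ValueSubst σ →
  ∃ λ W → subst σ (app (app (lam P) Q) L) ⇓ W × W ⇛ W'

⇓-backward-σ₃ : ∀ {V V' L L' Q Q' σ σ' U' R' A' W'} →
  subst σ' Q' ⇓ U' → subst (exts σ') (shift V') [ U' ] ⇓ lam R' →
  subst (exts σ') L' [ U' ] ⇓ A' → R' [ A' ] ⇓ W' →
  V ⇛ V' → Value V → L ⇛ L' → Q ⇛ Q' → σ ⇛ₛ σ' → ValueSubst σ →
  ∃ λ W → subst σ (app V (app (lam L) Q)) ⇓ W × W ⇛ W'

⇓-backward d (pvar {i}) ps vs refl with value-⇓ (value-⇛ (vs i) (ps i)) d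
... | refl = _ , ev-val (vs i) , ps i
⇓-backward d (plam p) ps vs refl with value-⇓ v-lam d
... | refl = _ , ev-val v-lam , plam (subst-⇛ p (exts-⇛ ps) (exts-value vs))
⇓-backward (ev-app {P = B'} {V = U'} dM dN dB) (papp p q) ps vs refl
  with ⇓-backward dM p ps vs refl | ⇓-backward dN q ps vs refl
... | F , eM , pF | U , eN , pU
  with value-⇛-lam (⇓-value eM) pF
... | B , refl , pB
  with ⇓-backward dB pB (•-⇛ pU var-⇛) (•-value (⇓-value eN) var-value) ([]-as-subst B' U')
... | W , eB , pW = W , ev-app eM eN (transport (_⇓ W) (sym ([]-as-subst B U)) eB) , pW
⇓-backward {σ = σ} {σ' = σ'} d (pβ {M = P} {M' = P'} {V = V} {V' = V'} p q v) ps vs eq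
  with ⇓-backward d p (•-⇛ (subst-⇛ q ps vs) ps) (•-value (value-subst vs v) vs)
                    (trans eq (subst-[] σ' P' V'))
... | W , e , pW = W , ev-app (ev-val v-lam) (ev-val (value-subst vs v))
                         (transport (_⇓ W) (sym (exts-[] σ P (subst σ V))) e) , pW
⇓-backward (ev-app (ev-val _) dQ (ev-app dP dL dR)) (pσ₁ p q r) ps vs refl =
  ⇓-backward-σ₁ dQ dP dL dR p q r ps vs
⇓-backward (ev-app (ev-val _) dQ (ev-app dV dL dR)) (pσ₃ p v q r) ps vs refl =
  ⇓-backward-σ₃ dQ dV dL dR p v q r ps vs

⇓-backward-σ₁ {P = P} {P' = P'} {L' = L'} {σ = σ} {σ' = σ'} {U' = U'} {R' = R'} {A' = A'}
              dQ dP dL dR p q r ps vs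
  with ⇓-backward dQ q ps vs refl
... | U , eQ , pU
  with ⇓-backward dP p (•-⇛ pU ps) (•-value (⇓-value eQ) vs) (exts-[] σ' P' U')
     | ⇓-backward dL r ps vs (subst-shift-[] σ' L' U')
... | F , eP , pF | A , eL , pA
  with value-⇛-lam (⇓-value eP) pF
... | R , refl , pR
  with ⇓-backward dR pR (•-⇛ pA var-⇛) (•-value (⇓-value eL) var-value) ([]-as-subst R' A')
... | W , eR , pW =
  W , ev-app (ev-app (ev-val v-lam) eQ (transport (_⇓ lam R) (sym (exts-[] σ P U)) eP))
             eL (transport (_⇓ W) (sym ([]-as-subst R A)) eR) , pW

⇓-backward-σ₃ {V = V} {V' = V'} {L = L} {L' = L'} {σ = σ} {σ' = σ'} {U' = U'} {R' = R'} {A' = A'}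
              dQ dV dL dR p v q r ps vs
  with ⇓-backward dQ r ps vs refl
... | U , eQ , pU
  with ⇓-backward dL q (•-⇛ pU ps) (•-value (⇓-value eQ) vs) (exts-[] σ' L' U')
... | A , eL , pA
  with value-⇓ (value-subst (value-subst-⇛ vs ps) (value-⇛ v p))
               (transport (_⇓ lam R') (subst-shift-[] σ' V' U') dV)
... | V'≡λR'
  with value-⇛-lam (value-subst vs v) (transport (subst σ V ⇛_) (sym V'≡λR') (subst-⇛ p ps vs))
... | R , V≡λR , pR
  with ⇓-backward dR pR (•-⇛ pA var-⇛) (•-value (⇓-value eL) var-value) ([]-as-subst R' A')
... | W , eR , pW =
  W , ev-app (transport (_⇓ lam R) (sym V≡λR) (ev-val v-lam))
             (ev-app (ev-val v-lam) eQ (transport (_⇓ A) (sym (exts-[] σ L U)) eL))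
             (transport (_⇓ W) (sym ([]-as-subst R A)) eR) , pW

-- Head reduction and big-step evaluation define the same notion of halting

apps-⇓ : ∀ {X Y} → (∀ {W} → Y ⇓ W → X ⇓ W) → ∀ Ms {W} → apps Y Ms ⇓ W → apps X Ms ⇓ W
apps-⇓ head []       d = head d
apps-⇓ head (L ∷ Ms) d = apps-⇓ (λ { (ev-app dY dL dB) → ev-app (head dY) dL dB }) Ms d

→hβv-⇓ : ∀ {M M'} → M →hβv M' → ∀ {W} → M' ⇓ W → M ⇓ W
→hβv-⇓ (hβ Ms v)    = apps-⇓ (ev-app (ev-val v-lam) (ev-val v)) Ms
→hβv-⇓ (hAr Ms v s) = apps-⇓ (λ { (ev-app dV dN dB) → ev-app dV (→hβv-⇓ s dN) dB }) Ms

→hβv*-⇓ : ∀ {M V} → M →hβv* V → Value V → M ⇓ V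
→hβv*-⇓ ε        v = ev-val v
→hβv*-⇓ (s ◅ ss) v = →hβv-⇓ s (→hβv*-⇓ ss v)

→hβv-appL : ∀ {X Y} L → X →hβv Y → app X L →hβv app Y L
→hβv-appL L (hβ {M} {V} Ms v) =
  transport₂ _→hβv_ (foldl-∷ʳ app (app (lam M) V) L Ms) (foldl-∷ʳ app (M [ V ]) L Ms)
    (hβ (Ms ∷ʳ L) v)
→hβv-appL L (hAr {V} {N} {N'} Ms v s) =
  transport₂ _→hβv_ (foldl-∷ʳ app (app V N) L Ms) (foldl-∷ʳ app (app V N') L Ms)
    (hAr (Ms ∷ʳ L) v s)

→hβv*-appL : ∀ {X Y} L → X →hβv* Y → app X L →hβv* app Y L
→hβv*-appL L ε        = ε
→hβv*-appL L (s ◅ ss) = →hβv-appL L s ◅ →hβv*-appL L ss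

→hβv*-appR : ∀ {X Y V} → Value V → X →hβv* Y → app V X →hβv* app V Y
→hβv*-appR v ε        = ε
→hβv*-appR v (s ◅ ss) = hAr [] v s ◅ →hβv*-appR v ss

⇓-→hβv* : ∀ {M W} → M ⇓ W → M →hβv* W
⇓-→hβv* (ev-val v)                   = ε
⇓-→hβv* (ev-app {N = N} dM dN dB) =
  →hβv*-appL N (⇓-→hβv* dM) ◅◅ →hβv*-appR v-lam (⇓-→hβv* dN) ◅◅
  hβ [] (⇓-value dN) ◅ ⇓-→hβv* dB

⇛-preserves-halting : ∀ {M N} → M ⇛ N → Halts M → Halts N
⇛-preserves-halting p (V , v , ss) with ⇓-forward (→hβv*-⇓ ss v) p
... | W' , e , _ = W' , ⇓-value e , ⇓-→hβv* e

⇛-reflects-halting : ∀ {M N} → M ⇛ N → Halts N → Halts M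
⇛-reflects-halting {M} {N} p (V , v , ss)
  with ⇓-backward (→hβv*-⇓ ss v) p var-⇛ var-value (sym (subst-var N))
... | W , e , _ = W , ⇓-value e , ⇓-→hβv* (transport (_⇓ W) (subst-var M) e)

≅-isEquivalence : IsEquivalence _≅_
≅-isEquivalence = record
  { refl  = λ C → id , id
  ; sym   = λ M≅N C → swap (M≅N C)
  ; trans = λ M≅N N≅L C → proj₁ (N≅L C) ∘ proj₁ (M≅N C) , proj₂ (M≅N C) ∘ proj₂ (N≅L C)
  }

→v⊆≅ : ∀ {M N} → M →v N → M ≅ N
→v⊆≅ s C = ⇛-preserves-halting p , ⇛-reflects-halting p
  where p = plug-⇛ C (→v⊆⇛ s)

-- Corollary 5.5: =v is the least equivalence containing →v, and ≅ is one.
corollary5p5 : ∀ (M N : Term) → M =v N → M ≅ N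
corollary5p5 M N = fold ≅-isEquivalence →v⊆≅
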